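{- Let $f:\mathbb{B}^n\to\mathbb{B}^n$ be a Boolean network in which component $n$ is not autoregulated, and let $S\in\{0,1,\star\}^n$ be a subspace in which component $n$ is free ($S_n=\star$). Then $C(\tilde f, S_{[n-1]}) = \widetilde{C(f,S)}$, where $\tilde g$ denotes the reduction of a network $g$ by elimination of component $n$.
   Context: $\mathbb{B}=\{0,1\}$, $[n]=\{1,\dots,n\}$; a Boolean network is a map $f:\mathbb{B}^n\to\mathbb{B}^n$ with coordinate functions $f_i$. For $x\in\mathbb{B}^n$ and $i\in[n]$, $\bar x^i$ denotes $x$ with coordinate $i$ flipped. Component $i$ regulates component $j$ if there is $x\in\mathbb{B}^n$ with $f_j(x)\neq f_j(\bar x^i)$; $n$ is autoregulated if $n$ regulates $n$. A subspace is a set of the form $\{x\in\mathbb{B}^n: x_i=c(i)\ \forall i\in I\}$ for some $I\subseteq[n]$ and $c:I\to\{0,1\}$; it is written as an element $S\in\{0,1,\star\}^n$ with $S_i=c(i)$ for $i\in I$ (fixed components) and $S_i=\star$ otherwise (free components). For $J\subseteq[n]$ and $A\subseteq\mathbb{B}^n$, $A_J$ is the projection of $A$ onto the coordinates in $J$. Reduction: if $n$ is not autoregulated, then $f_n(x,0)=f_n(x,1)$ for all $x\in\mathbb{B}^{n-1}$; set $\sigma(x)=(x,f_n(x,0))\in\mathbb{B}^n$ (the representative state of $x$) and define $\tilde f:\mathbb{B}^{n-1}\to\mathbb{B}^{n-1}$ by $\tilde f_i(x)=f_i(\sigma(x))$ for $i\in[n-1]$. Control: for a subspace $S$, the network $C(f,S):\mathbb{B}^n\to\mathbb{B}^n$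 is defined by $C(f,S)_i=f_i$ if $i$ is free in $S$, and $C(f,S)_i\equiv S_i$ (constant) if $i$ is fixed in $S$. -}

module Defs where

open import Data.Nat using (ℕ; suc)
open import Data.Fin using (Fin; fromℕ; inject₁)
open import Data.Bool using (Bool; true; false; not)
open import Data.Maybe using (Maybe; just; nothing)
open import Data.Vec.Functional using (Vector; insertAt; updateAt)
open import Data.Product using (∃)
open import Relation.Binary.PropositionalEquality using (_≡_)
open import Relation.Nullary using (¬_)

State : ℕ → Set
State n = Vector Bool n

BN : ℕ → Set
BN n = State n → State n

flip : ∀ {n} → State n → Fin n → State n
flip x i = updateAt x i not

Regulates : ∀ {n} → BN n → Fin n → Fin n → Set
Regulates f i j = ∃ λ x → ¬ (f x j ≡ f (flip x i) j)

-- The last component (component n of B^(m+1), with n = m+1).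
last : ∀ m → Fin (suc m)
last m = fromℕ m

Autoregulated : ∀ {m} → BN (suc m) → Set
Autoregulated {m} f = Regulates f (last m) (last m)

extend : ∀ {m} → State m → Bool → State (suc m)
extend {m} x b = insertAt x (last m) b

σ : ∀ {m} → BN (suc m) → State m → State (suc m)
σ {m} f x = extend x (f (extend x false) (last m))

reduce : ∀ {m} → BN (suc m) → BN m
reduce f x i = f (σ f x) (inject₁ i)

-- Subspaces as elements of {0,1,⋆}^n; nothing = ⋆ (free), just b = fixed to b.
Subspace : ℕ → Set
Subspace n = Vector (Maybe Bool) n

projInit : ∀ {m} → Subspace (suc m) → Subspace m
projInit S i = S (inject₁ i)

controlAt : Maybe Bool → Bool → Bool
controlAt nothing  v = v
controlAt (just c) v = c

C : ∀ {n} → BN n → Subspace n → BN n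
C f S x i = controlAt (S i) (f x i)

{-# OPTIONS --safe #-}
module Submission where

open import Defs
open import Data.Nat using (ℕ; suc)
open import Data.Fin using (Fin; inject₁)
open import Data.Bool using (false)
open import Data.Maybe using (nothing)
open import Relation.Binary.PropositionalEquality using (_≡_; refl; cong; sym)
open import Relation.Nullary using (¬_)

C-free : ∀ {n} (f : BN n) (S : Subspace n) x (i : Fin n) →
         S i ≡ nothing → C f S x i ≡ f x i
C-free f S x i free rewrite free = refl

σ-C-free : ∀ {m} (f : BN (suc m)) (S : Subspace (suc m)) →
           S (last m) ≡ nothing → ∀ x → σ (C f S) x ≡ σ f x
σ-C-free {m} f S free x = cong (extend x) (C-free f S (extend x false) (last m) free)

-- Non-autoregulation is deliberately unused: σ reads f_n at (x,0) by definition;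
-- the hypothesis only makes this choice canonical (f_n(x,0) = f_n(x,1)).
proposition1 : ∀ (m : ℕ) (f : BN (suc m)) (S : Subspace (suc m)) →
    ¬ Autoregulated f → S (last m) ≡ nothing →
    ∀ x i → C (reduce f) (projInit S) x i ≡ reduce (C f S) x i
proposition1 m f S _ free x i =
  cong (λ y → controlAt (S (inject₁ i)) (f y (inject₁ i))) (sym (σ-C-free f S free x))
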